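{- Let $R$ be a dwindling, convergent string rewriting system over a finite alphabet $\Sigma$, let $A \in \Sigma^+$ be irreducible with respect to $R$, and let $X \in \Sigma^+$. If $AX \rightarrow_R^* S$, then $S = A_{[1:b]}X_{[\beta]}$ for some integer $b \le |A|$ and some index sequence $\beta = (\beta_1,\dots,\beta_c)$ with $1 \le \beta_1 < \beta_2 < \dots < \beta_c \le |X|$. Additionally, $c < |X|$ if $S \neq AX$.
   Context: A string rewriting system $R$ over $\Sigma$ is a set of rules $l \rightarrow r$ with $l,r\in\Sigma^*$, with one-step rewriting $u \rightarrow_R v$ iff $u = xly$, $v = xry$ for a rule $l\rightarrow r$ and $x,y\in\Sigma^*$; $\rightarrow_R^*$ is its reflexive-transitive closure. $R$ is convergent if it is terminating and confluent. $R$ is dwindling if for every rule $l \rightarrow r$, $r$ is a proper prefix of $l$. A string is irreducible if no rule applies to it. For a string $x$, $x_{[i]}$ is its $i$-th symbol, $x_{[i:j]}$ is the substring from position $i$ to $j$ inclusive (the empty string if $i>j$), and for an index sequence $\beta=(\beta_1,\dots,\beta_c)$, $x_{[\beta]} = x_{[\beta_1]}x_{[\beta_2]}\cdots x_{[\beta_c]}$ (empty if $c=0$). -}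

module Defs where

open import Level using (Level; _⊔_) renaming (suc to lsuc)
open import Data.Nat using (ℕ; _<_; _≤_)
open import Data.Fin using (Fin; toℕ)
open import Data.List using (List; []; _∷_; _++_; length; map; lookup; take)
open import Data.List.Relation.Binary.Prefix.Heterogeneous using (Prefix)
open import Data.List.Relation.Unary.Linked using (Linked)
open import Data.Product using (Σ; ∃; _×_; _,_)
open import Relation.Binary.PropositionalEquality using (_≡_)
open import Relation.Binary.Construct.Closure.ReflexiveTransitive using (Star)
open import Relation.Nullary using (¬_)
open import Induction.WellFounded using (WellFounded)
open import Function.Bundles using (_↔_)

Finite : ∀ {a} → Set a → Set a
Finite A = Σ ℕ λ k → A ↔ Fin k

Str : ∀ {a} → Set a → Set a
Str = List

SRS : ∀ {a} (S : Set a) (ℓ : Level) → Set (a ⊔ lsuc ℓ)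
SRS S ℓ = Str S → Str S → Set ℓ

module _ {a ℓ} {S : Set a} (R : SRS S ℓ) where

  data Step : Str S → Str S → Set (a ⊔ ℓ) where
    step : ∀ x l r y → R l r → Step (x ++ l ++ y) (x ++ r ++ y)

  Steps : Str S → Str S → Set (a ⊔ ℓ)
  Steps = Star Step

  Terminating : Set (a ⊔ ℓ)
  Terminating = WellFounded (λ v u → Step u v)

  Confluent : Set (a ⊔ ℓ)
  Confluent = ∀ {u v w} → Steps u v → Steps u w →
              ∃ λ z → Steps v z × Steps w z

  Convergent : Set (a ⊔ ℓ)
  Convergent = Terminating × Confluent

  ProperPrefix : Str S → Str S → Set a
  ProperPrefix r l = Prefix _≡_ r l × length r < length l

  Dwindling : Set (a ⊔ ℓ)
  Dwindling = ∀ {l r} → R l r → ProperPrefix r l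

  Irreducible : Str S → Set (a ⊔ ℓ)
  Irreducible u = ∀ {v} → ¬ Step u v

NonEmpty : ∀ {a} {S : Set a} → Str S → Set
NonEmpty u = 0 < length u

-- Index sequences into a string x: lists of positions (0-based Fin
-- indices, corresponding to 1-based positions 1..|x| in the paper).
StrictlyIncreasing : ∀ {n} → List (Fin n) → Set
StrictlyIncreasing = Linked (λ i j → toℕ i < toℕ j)

select : ∀ {a} {S : Set a} (x : Str S) → List (Fin (length x)) → Str S
select x β = map (lookup x) β

{-# OPTIONS --safe #-}
-- Every descendant of A X has the form P Y with P a prefix of A and Y a
-- subsequence of X. A dwindling rule r s → r (s nonempty) deletes the factor s
-- at the end of its redex r s. If s ended inside P, the whole redex would lie
-- inside A, contradicting irreducibility; so s ends inside Y, and deleting it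
-- leaves a prefix of P followed by a subsequence of Y that has lost at least
-- one letter.
module Submission where

open import Defs
open import Level using (Level)
open import Data.Nat as ℕ using (ℕ; _<_; _≤_; z≤n; s≤s)
open import Data.Nat.Properties using (≤-<-trans; <-irrefl)
open import Data.Fin using (Fin; zero; suc)
open import Data.List using (List; []; _∷_; _++_; length; take; map)
open import Data.List.Properties using (++-assoc; ++-identityʳ; ∷-injective; length-map; map-∘; length-++-≤ˡ; length-++-≤ʳ)
open import Data.List.Relation.Binary.Prefix.Propositional.Properties using (Prefix-as-∣ˡ)
open import Data.List.Relation.Binary.Sublist.Propositional using (_⊆_; []; _∷_; _∷ʳ_; ⊆-refl; ⊆-trans)
open import Data.List.Relation.Binary.Sublist.Propositional.Properties using (++⁺ˡ; length-mono-≤)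
open import Data.List.Relation.Unary.Linked using ([]; [-]; _∷_)
import Data.List.Relation.Unary.Linked as Linked
import Data.List.Relation.Unary.Linked.Properties as Linked
open import Data.Product using (Σ; ∃; _×_; _,_; proj₁; proj₂)
open import Data.Sum using (_⊎_; inj₁; inj₂)
open import Function using (_∘_)
open import Relation.Binary.PropositionalEquality using (_≡_; _≢_; refl; sym; trans; cong; cong₂; subst)
open import Relation.Binary.Construct.Closure.ReflexiveTransitive using (ε; _◅_)
open import Relation.Nullary using (contradiction)

private
  variable
    a ℓ : Level
    S : Set a
    A X Y P Q T U : List S

++-equidivisible : ∀ (xs ys zs ws : List S) → xs ++ ys ≡ zs ++ ws →
  (∃ λ t → xs ≡ zs ++ t × ws ≡ t ++ ys) ⊎
  (∃ λ t → NonEmpty t × zs ≡ xs ++ t × ys ≡ t ++ ws)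
++-equidivisible []       ys []       ws eq = inj₁ ([] , refl , sym eq)
++-equidivisible []       ys (z ∷ zs) ws eq = inj₂ (z ∷ zs , s≤s z≤n , refl , eq)
++-equidivisible (x ∷ xs) ys []       ws eq = inj₁ (x ∷ xs , refl , sym eq)
++-equidivisible (x ∷ xs) ys (z ∷ zs) ws eq with ∷-injective eq
... | refl , eq′ with ++-equidivisible xs ys zs ws eq′
...   | inj₁ (t , refl , ws≡)       = inj₁ (t , refl , ws≡)
...   | inj₂ (t , t⁺ , refl , ys≡) = inj₂ (t , t⁺ , refl , ys≡)

take-length-++ : ∀ (xs ys : List S) → take (length xs) (xs ++ ys) ≡ xs
take-length-++ []       ys = refl
take-length-++ (x ∷ xs) ys = cong (x ∷_) (take-length-++ xs ys)

dwindling-rule-suffix : {R : SRS S ℓ} → Dwindling R → ∀ {l r} → R l r →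
                 ∃ λ s → NonEmpty s × l ≡ r ++ s
dwindling-rule-suffix dw {r = r} rl with dw rl
... | r⊑l , |r|<|l| with Prefix-as-∣ˡ r⊑l
...   | record { quotient = s@(_ ∷ _) ; equality = refl } = s , s≤s z≤n , refl
...   | record { quotient = []        ; equality = refl } =
        contradiction (subst (λ l → length r < length l) (++-identityʳ r) |r|<|l|) (<-irrefl refl)

infix 4 _⊏_
_⊏_ : {S : Set a} → List S → List S → Set a
xs ⊏ ys = xs ⊆ ys × length xs < length ys

⊏⇒⊆ : ∀ {xs ys : List S} → xs ⊏ ys → xs ⊆ ys
⊏⇒⊆ = proj₁

⊆-⊏-trans : ∀ {xs ys zs : List S} → xs ⊆ ys → ys ⊏ zs → xs ⊏ zs
⊆-⊏-trans τ (σ , |ys|<|zs|) = ⊆-trans τ σ , ≤-<-trans (length-mono-≤ τ) |ys|<|zs|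

delete-infix-⊏ : ∀ (ws : List S) {s} ys → NonEmpty s → ws ++ ys ⊏ ws ++ s ++ ys
delete-infix-⊏ []       {z ∷ s} ys _ = z ∷ʳ ++⁺ˡ s (⊆-refl {x = ys}) , s≤s (length-++-≤ʳ ys {s})
delete-infix-⊏ (w ∷ ws) ys s⁺ with delete-infix-⊏ ws ys s⁺
... | τ , |τ| = refl ∷ τ , s≤s |τ|

record Decomposition {S : Set a} (_≼_ : List S → List S → Set a) (A X T : List S) : Set a where
  constructor decomposition
  field
    {prefix rest residue} : List S
    splits-A  : prefix ++ rest ≡ A
    residue≼X : residue ≼ X
    splits-T  : T ≡ prefix ++ residue

open Decomposition

map-residue : ∀ {_≼_ _≼′_ : List S → List S → Set a} →
              (∀ {Z} → Z ≼ Y → Z ≼′ X) → Decomposition _≼_ A Y T → Decomposition _≼′_ A X T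
map-residue f (decomposition pq Y′≼Y T≡) = decomposition pq (f Y′≼Y) T≡

delete-infix : ∀ u s y → P ++ Q ≡ A → P ++ Y ≡ u ++ s ++ y → NonEmpty s →
               (∃ λ w → A ≡ u ++ s ++ w) ⊎ Decomposition _⊏_ A Y (u ++ y)
delete-infix {P = P} {Q = Q} {Y = Y} u s y refl eq s⁺
  with ++-equidivisible P Y (u ++ s) y (trans eq (sym (++-assoc u s y)))
... | inj₁ (w , refl , _) = inj₁ (w ++ Q , trans (++-assoc (u ++ s) w Q) (++-assoc u s (w ++ Q)))
... | inj₂ (t , t⁺ , us≡Pt , refl) with ++-equidivisible u s P t us≡Pt
...   | inj₁ (w , refl , refl) =
        inj₂ (decomposition {prefix = P} refl
                (subst (_ ⊏_) (sym (++-assoc w s y)) (delete-infix-⊏ w y s⁺))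
                (++-assoc P w y))
...   | inj₂ (t′ , _ , refl , refl) =
        inj₂ (decomposition (sym (++-assoc u t′ Q)) (delete-infix-⊏ [] y t⁺) refl)

++-regroup : ∀ (x r s w : List S) → x ++ (r ++ s) ++ w ≡ (x ++ r) ++ s ++ w
++-regroup x r s w = trans (cong (x ++_) (++-assoc r s w)) (sym (++-assoc x r (s ++ w)))

step-decomposition : {R : SRS S ℓ} → Dwindling R → Irreducible R A →
                     P ++ Q ≡ A → Step R U T → U ≡ P ++ Y → Decomposition _⊏_ A Y T
step-decomposition {A = A} {Y = Y} dw irr pq (step x l r y rl) U≡ with dwindling-rule-suffix dw rl
... | s , s⁺ , refl with delete-infix (x ++ r) s y pq (trans (sym U≡) (++-regroup x r s y)) s⁺
...   | inj₁ (w , A≡) = contradiction redex-in-A irr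
  where
  redex-in-A : Step _ A (x ++ r ++ w)
  redex-in-A = subst (λ B → Step _ B _) (trans (++-regroup x r s w) (sym A≡)) (step x (r ++ s) r w rl)
...   | inj₂ d        = subst (Decomposition _⊏_ A Y) (++-assoc x r y) d

steps-decomposition : {R : SRS S ℓ} → Dwindling R → Irreducible R A →
                      P ++ Q ≡ A → Steps R U T → U ≡ P ++ Y → Decomposition _⊆_ A Y T

plus-decomposition : {R : SRS S ℓ} → Dwindling R → Irreducible R A → ∀ {V} →
                     P ++ Q ≡ A → Step R U V → Steps R V T → U ≡ P ++ Y → Decomposition _⊏_ A Y T
plus-decomposition dw irr pq s rest U≡ with step-decomposition dw irr pq s U≡
... | decomposition pq′ Y′⊏Y V≡ =
      map-residue (λ Z⊆Y′ → ⊆-⊏-trans Z⊆Y′ Y′⊏Y) (steps-decomposition dw irr pq′ rest V≡)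

steps-decomposition dw irr pq ε          refl = decomposition pq ⊆-refl refl
steps-decomposition dw irr pq (s ◅ rest) U≡   = map-residue ⊏⇒⊆ (plus-decomposition dw irr pq s rest U≡)

descendant-decomposition : {R : SRS S ℓ} → Dwindling R → Irreducible R A → Steps R (A ++ X) T →
                           Σ (Decomposition _⊆_ A X T) λ d → T ≢ A ++ X → length (residue d) < length X
descendant-decomposition {A = A} dw irr ε = decomposition (++-identityʳ A) ⊆-refl refl , λ T≢ → contradiction refl T≢
descendant-decomposition {A = A} dw irr (s ◅ rest) =
  map-residue ⊏⇒⊆ d , λ _ → proj₂ (residue≼X d)
  where d = plus-decomposition dw irr (++-identityʳ A) s rest refl

indices : ∀ {ys xs : List S} → ys ⊆ xs → List (Fin (length xs))
indices []       = []
indices (_ ∷ʳ τ) = map suc (indices τ)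
indices (_ ∷ τ)  = zero ∷ map suc (indices τ)

length-indices : ∀ {ys xs : List S} (τ : ys ⊆ xs) → length (indices τ) ≡ length ys
length-indices []       = refl
length-indices (_ ∷ʳ τ) = trans (length-map suc (indices τ)) (length-indices τ)
length-indices (_ ∷ τ)  = cong ℕ.suc (trans (length-map suc (indices τ)) (length-indices τ))

select-indices : ∀ {ys xs : List S} (τ : ys ⊆ xs) → select xs (indices τ) ≡ ys
select-indices []          = refl
select-indices (_ ∷ʳ τ)    = trans (sym (map-∘ (indices τ))) (select-indices τ)
select-indices (refl ∷ τ)  = cong (_ ∷_) (trans (sym (map-∘ (indices τ))) (select-indices τ))

suc-increasing : ∀ {n} {β : List (Fin n)} → StrictlyIncreasing β → StrictlyIncreasing (map suc β)
suc-increasing = Linked.map⁺ ∘ Linked.map s≤s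

indices-increasing : ∀ {ys xs : List S} (τ : ys ⊆ xs) → StrictlyIncreasing (indices τ)
indices-increasing []       = []
indices-increasing (_ ∷ʳ τ) = suc-increasing (indices-increasing τ)
indices-increasing (_ ∷ τ) with indices τ | indices-increasing τ
... | []    | _  = [-]
... | _ ∷ _ | ↗ = s≤s z≤n ∷ suc-increasing ↗

lemma1p5 : ∀ {a ℓ} {S : Set a} → Finite S →
    (R : SRS S ℓ) → Dwindling R → Convergent R →
    (A X T : Str S) → NonEmpty A → Irreducible R A → NonEmpty X →
    Steps R (A ++ X) T →
    Σ ℕ λ b → Σ (List (Fin (length X))) λ β →
      b ≤ length A × StrictlyIncreasing β ×
      T ≡ take b A ++ select X β ×
      (T ≢ A ++ X → length β < length X)
lemma1p5 _ R dw _ A X T _ irr _ A++X→T with descendant-decomposition dw irr A++X→T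
... | decomposition {P} {Q} {Y} refl Y⊆X refl , shrinks =
  length P , indices Y⊆X , length-++-≤ˡ P , indices-increasing Y⊆X ,
  cong₂ _++_ (sym (take-length-++ P Q)) (sym (select-indices Y⊆X)) ,
  subst (_< length X) (sym (length-indices Y⊆X)) ∘ shrinks
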